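{- Let $f(x)\in\mathbb{C}(x)$ be a monic rational function of degree $n\in\mathbb{Z}$, let $(b_j)_{j\in\mathbb{Z}}$ be a sequence of complex numbers, and let $(q_m(x))_{m\in\mathbb{Z}}$ be the sequence of rational functions with persistent roots $(b_j)$. Then, as an identity of formal Laurent series in $x^{ -1}$, $$f(x)=\sum_{k=0}^{\infty}\mathrm{comp}_k\big(\mathrm{Roots}(f)-\{b_1..b_{n-k+1}\}\big)\,q_{n-k}(x).$$
   Context: A hybrid set on a universe $U$ is a function $f:U\to\mathbb{Z}$; sums/differences are pointwise. For a finitely supported hybrid set $V$ of complex numbers, $\mathrm{comp}_k(V)$ is the coefficient of $t^k$ in $\prod_{c\in\mathbb{C}}(1-ct)^{V(c)}\in\mathbb{C}[[t]]$. For a sequence $(b_j)_{j\in\mathbb{Z}}$ and an integer $m$, the hybrid set $\{b_1..b_m\}$ is $\{b_1|\}+\dots+\{b_m|\}$ if $m\ge1$, empty if $m=0$, and $-(\{b_{m+1}|\}+\dots+\{b_0|\})$ if $m\le-1$ (where $\{c|\}$ has multiplicity $1$ at $c$ and $0$ elsewhere). The sequence with persistent roots $(b_j)$ is $q_m(x)=\prod_{i\in\{1..m\}}(x-b_i)$, i.e. $q_m(x)=(x-b_1)\cdots(x-b_m)$ for $m\ge0$ and $q_m(x)=1/\big((x-b_0)(x-b_{ -1})\cdots(x-b_{m+1})\big)$ for $m<0$. The degree of a rational function $p/r$ is $\deg p-\deg r$, and it is monic if the ratio of the leading coefficients of $p$ and $r$ is $1$. $\mathrm{Roots}(f)$ is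 the hybrid set on $\mathbb{C}$ assigning to each $c$ its multiplicity as a root of $f$, with poles counted with negative multiplicity (so $f(x)=\prod_{c}(x-c)^{\mathrm{Roots}(f)(c)}$). Each $q_{n-k}(x)$ is expanded as a Laurent series in $x^{ -1}$ with leading term $x^{n-k}$, so the sum converges formally. -}

module Defs where

open import Level using (Level; _⊔_) renaming (suc to lsuc)
open import Data.Nat as ℕ using (ℕ; zero; suc; _≤ᵇ_; _<_)
open import Data.Integer as ℤ using (ℤ; +_; -[1+_])
open import Data.Bool using (if_then_else_)
open import Data.List using (List; []; _∷_; map; _++_; upTo)
open import Data.Product using (_×_; _,_; ∃)
open import Relation.Nullary using (¬_)
open import Algebra.Bundles using (CommutativeRing)

record Field c ℓ : Set (lsuc (c ⊔ ℓ)) where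
  field commutativeRing : CommutativeRing c ℓ
  open CommutativeRing commutativeRing public
  field
    0≉1     : ¬ (0# ≈ 1#)
    inverse : ∀ x → ¬ (x ≈ 0#) → ∃ λ y → x * y ≈ 1#

module Over {c ℓ} (F : Field c ℓ) where
  open Field F public using (Carrier; _≈_; _+_; _*_; -_; 0#; 1#)

  sumTo : (ℕ → Carrier) → ℕ → Carrier
  sumTo f zero    = f zero
  sumTo f (suc n) = sumTo f n + f (suc n)

  pow : Carrier → ℕ → Carrier
  pow a zero    = 1#
  pow a (suc n) = a * pow a n

  natK : ℕ → Carrier
  natK zero    = 0#
  natK (suc n) = 1# + natK n

  -- Polynomials: coefficient of x^i is cf i, degree deg, nonzero
  -- leading coefficient cf deg (so the zero polynomial is excluded).
  record Poly : Set (c ⊔ ℓ) where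
    field
      deg    : ℕ
      cf     : ℕ → Carrier
      vanish : ∀ i → deg < i → cf i ≈ 0#
      lc≉0   : ¬ (cf deg ≈ 0#)
    lc : Carrier
    lc = cf deg
  open Poly public

  eval : Poly → Carrier → Carrier
  eval p a = sumTo (λ i → cf p i * pow a i) (deg p)

  -- the field is of characteristic zero / algebraically closed (as ℂ is)
  CharZero : Set ℓ
  CharZero = ∀ n → ¬ (natK (suc n) ≈ 0#)

  AlgClosed : Set (c ⊔ ℓ)
  AlgClosed = ∀ (p : Poly) → 1 ℕ.≤ deg p → ∃ λ a → eval p a ≈ 0#

  PS : Set c
  PS = ℕ → Carrier

  _*ₚ_ : PS → PS → PS
  (a *ₚ b) i = sumTo (λ j → a j * b (i ℕ.∸ j)) i

  oneₚ : PS
  oneₚ zero    = 1#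
  oneₚ (suc _) = 0#

  powₚ : PS → ℕ → PS
  powₚ a zero    = oneₚ
  powₚ a (suc n) = a *ₚ powₚ a n

  linₚ : Carrier → PS
  linₚ a zero          = 1#
  linₚ a (suc zero)    = - a
  linₚ a (suc (suc _)) = 0#

  -- (1 - c t)^{-1} = Σ_j c^j t^j
  invLinₚ : Carrier → PS
  invLinₚ a j = pow a j

  -- Finitely supported hybrid sets on the field, presented as a list of
  -- (element, multiplicity) pairs; the hybrid set is the pointwise sum
  -- of the single-point hybrid sets, so list append is hybrid-set sum.
  Hybrid : Set c
  Hybrid = List (Carrier × ℤ)

  negH : Hybrid → Hybrid
  negH = map (λ { (a , m) → (a , ℤ.- m) })

  factorₚ : Carrier → ℤ → PS
  factorₚ a (+ n)    = powₚ (linₚ a) n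
  factorₚ a -[1+ n ] = powₚ (invLinₚ a) (suc n)

  prodₚ : Hybrid → PS
  prodₚ []             = oneₚ
  prodₚ ((a , m) ∷ V)  = factorₚ a m *ₚ prodₚ V

  comp : ℕ → Hybrid → Carrier
  comp k V = prodₚ V k

  interval : (ℤ → Carrier) → ℤ → Hybrid
  interval b (+ n)    = map (λ i → (b (+ suc i) , + 1)) (upTo n)
  interval b -[1+ n ] = map (λ i → (b (ℤ.- (+ i)) , ℤ.- (+ 1))) (upTo (suc n))

  -- Formal Laurent series in x^{-1} : Σ_{i ≥ 0} co i · x^{top - i}.
  record LS : Set c where
    constructor mkLS
    field
      top : ℤ
      co  : ℕ → Carrier
  open LS public

  coeff : LS → ℤ → Carrier
  coeff L e with top L ℤ.- e
  ... | + k      = co L k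
  ... | -[1+ _ ] = 0#

  _≈ₗ_ : LS → LS → Set ℓ
  L ≈ₗ M = ∀ e → coeff L e ≈ coeff M e

  _*ₗ_ : LS → LS → LS
  L *ₗ M = mkLS (top L ℤ.+ top M) (co L *ₚ co M)

  oneₗ : LS
  oneₗ = mkLS (+ 0) oneₚ

  powₗ : LS → ℕ → LS
  powₗ L zero    = oneₗ
  powₗ L (suc n) = L *ₗ powₗ L n

  linₗ : Carrier → LS
  linₗ a = mkLS (+ 1) (linₚ a)

  -- (x - c)^{-1} = Σ_j c^j x^{-1-j}
  invLinₗ : Carrier → LS
  invLinₗ a = mkLS (ℤ.- (+ 1)) (λ j → pow a j)

  factorₗ : Carrier → ℤ → LS
  factorₗ a (+ n)    = powₗ (linₗ a) n
  factorₗ a -[1+ n ] = powₗ (invLinₗ a) (suc n)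

  prodₗ : Hybrid → LS
  prodₗ []            = oneₗ
  prodₗ ((a , m) ∷ V) = factorₗ a m *ₗ prodₗ V

  scaleₗ : Carrier → LS → LS
  scaleₗ a L = mkLS (top L) (λ i → a * co L i)

  polyₗ : Poly → LS
  polyₗ p = mkLS (+ deg p) (λ i → if i ≤ᵇ deg p then cf p (deg p ℕ.∸ i) else 0#)

  q : (ℤ → Carrier) → ℤ → LS
  q b m = prodₗ (interval b m)

  ofList : List Carrier → Hybrid
  ofList = map (λ a → (a , + 1))

  -- Roots(p/r) given complete root lists αs of p and βs of r
  rootsFrac : List Carrier → List Carrier → Hybrid
  rootsFrac αs βs = ofList αs ++ negH (ofList βs)

  -- Σ_{k ≥ 0} comp_k(R - {b_1..b_{n-k+1}}) q_{n-k}(x), a Laurent series with top degree n;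
  -- its x^{n-i} coefficient only involves k ≤ i since q_{n-k} has top degree n-k.
  expansionSum : (ℤ → Carrier) → ℤ → Hybrid → LS
  expansionSum b n R =
    mkLS n (λ i → sumTo (λ k → comp k (R ++ negH (interval b (n ℤ.- + k ℤ.+ + 1)))
                                 * coeff (q b (n ℤ.- + k)) (n ℤ.- + i)) i)

-- Reading a Laurent series Σ c_i x^{top - i} as the power series Σ c_i t^i (t = 1/x) respects
-- products, and turns the theorem into an identity of power series. With
-- Q_m = ∏_{i ∈ {b_1..b_m}} (1 - b_i t) and G = ∏_c (1 - c t)^{Roots(f)(c)}, it suffices to show
-- G = Σ_k c_k t^k Q_{n-k} where c_k = [t^k] G / Q_{n-k+1}; multiplying by the series lc(r) ∏_β (1 - β t)
-- of r then gives the series lc(p) ∏_α (1 - α t) of p.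
-- Let T_K = Σ_{k<K} c_k t^k Q_{n-k}. Since Q_{m+1} = Q_m (1 - b_{m+1} t) for every m ∈ ℤ, each
-- t^k Q_{n-k} / Q_{n-K+1} with k < K is a polynomial of degree < K, hence so is T_K / Q_{n-K+1}.
-- By induction on K it agrees with G / Q_{n-K+1} in all degrees < K: passing from K to K+1 multiplies
-- both by 1 - b_{n-K+1} t, and the new term of T_{K+1} contributes exactly c_K t^K. Multiplying back
-- by Q_{n-K+1}, G agrees with T_K below degree K.

module Submission where

open import Defs
open import Data.Integer using (ℤ; +_; _-_)
open import Data.List using (List)
open import Relation.Binary.PropositionalEquality using (_≡_)

open import Algebra.Bundles using (CommutativeMonoid)
import Algebra.Properties.CommutativeSemigroup as CommutativeSemigroupProperties
open import Algebra.Structures using (IsCommutativeMonoid)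
open import Algebra.Structures.Biased using (isCommutativeMonoidˡ)
open import Data.Empty using (⊥-elim)
open import Data.Integer as ℤ using (-[1+_])
import Data.Integer.Properties as ℤ
open import Data.Integer.Tactic.RingSolver using (solve-∀)
open import Data.List using ([]; _∷_; _++_; map; upTo; length)
import Data.List.Properties as List
open import Data.Nat as ℕ using (ℕ; zero; suc; _∸_; s≤s)
import Data.Nat.Properties as ℕ
open import Data.Product using (_,_)
open import Data.Sum using (inj₁; inj₂)
open import Function using (_∘_)
open import Relation.Binary.Bundles using (Setoid)
open import Relation.Binary.Definitions using (tri<; tri≈; tri>)
import Relation.Binary.PropositionalEquality as ≡
import Relation.Binary.Reasoning.Setoid as SetoidReasoning
open import Relation.Nullary using (¬_)

m-[1+n]+1≡m-n : ∀ m n → m - (+ 1 ℤ.+ n) ℤ.+ + 1 ≡ m - n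
m-[1+n]+1≡m-n = solve-∀

[m-n]-[m-o]≡o-n : ∀ m n o → (m - n) - (m - o) ≡ o - n
[m-n]-[m-o]≡o-n = solve-∀

m-[m-n]≡n : ∀ m n → m - (m - n) ≡ n
m-[m-n]≡n = solve-∀

n+[m-n]≡m : ∀ m n → n ℤ.+ (m - n) ≡ m
n+[m-n]≡m = solve-∀

+m-+n≡+[m∸n] : ∀ {m n} → n ℕ.≤ m → + m - + n ≡ + (m ∸ n)
+m-+n≡+[m∸n] {m} {n} n≤m = ≡.trans (ℤ.m-n≡m⊖n m n) (ℤ.⊖-≥ n≤m)

m<n⇒m-n<0 : ∀ {m n} → m ℤ.< n → m - n ℤ.< + 0
m<n⇒m-n<0 {m} {n} m<n = ≡.subst (m - n ℤ.<_) (ℤ.+-inverseʳ n) (ℤ.+-monoˡ-< (ℤ.- n) m<n)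

module Series {c ℓ} (F : Field c ℓ) where
  open Over F
  open Field F using (setoid; refl; sym; trans; +-cong; *-cong; *-congˡ; +-assoc; +-comm;
    *-assoc; *-comm; +-identityˡ; +-identityʳ; *-identityˡ; zeroˡ; zeroʳ; distribˡ; distribʳ;
    -‿inverseʳ; +-commutativeSemigroup)
  open SetoidReasoning setoid
  module +-Properties = CommutativeSemigroupProperties +-commutativeSemigroup

  infix 4 _≋_
  _≋_ : PS → PS → Set ℓ
  X ≋ Y = ∀ i → X i ≈ Y i

  ≋-setoid : Setoid c ℓ
  ≋-setoid = record
    { Carrier       = PS
    ; _≈_           = _≋_
    ; isEquivalence = record
      { refl  = λ _ → refl
      ; sym   = λ X≋Y i → sym (X≋Y i)
      ; trans = λ X≋Y Y≋Z i → trans (X≋Y i) (Y≋Z i)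
      }
    }

  open Setoid ≋-setoid public using ()
    renaming (refl to ≋-refl; sym to ≋-sym; trans to ≋-trans; reflexive to ≋-reflexive)

  zeroₚ : PS
  zeroₚ _ = 0#

  infixl 6 _+ₚ_
  _+ₚ_ : PS → PS → PS
  (X +ₚ Y) i = X i + Y i

  infixr 7 _·ₚ_
  _·ₚ_ : Carrier → PS → PS
  (a ·ₚ X) i = a * X i

  shift : ℕ → PS → PS
  shift zero    X         = X
  shift (suc K) X zero    = 0#
  shift (suc K) X (suc i) = shift K X i

  sumTo-cong : ∀ {f g} n → (∀ j → j ℕ.≤ n → f j ≈ g j) → sumTo f n ≈ sumTo g n
  sumTo-cong zero    f≈g = f≈g 0 ℕ.z≤n
  sumTo-cong (suc n) f≈g =
    +-cong (sumTo-cong n (λ j j≤n → f≈g j (ℕ.m≤n⇒m≤1+n j≤n))) (f≈g (suc n) ℕ.≤-refl)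

  sumTo-suc : ∀ f n → sumTo f (suc n) ≈ f 0 + sumTo (f ∘ suc) n
  sumTo-suc f zero    = refl
  sumTo-suc f (suc n) = trans (+-cong (sumTo-suc f n) refl) (+-assoc _ _ _)

  sumTo-+ : ∀ f g n → sumTo (λ j → f j + g j) n ≈ sumTo f n + sumTo g n
  sumTo-+ f g zero    = refl
  sumTo-+ f g (suc n) = trans (+-cong (sumTo-+ f g n) refl) (+-Properties.interchange _ _ _ _)

  sumTo-*ˡ : ∀ k f n → sumTo (λ j → k * f j) n ≈ k * sumTo f n
  sumTo-*ˡ k f zero    = refl
  sumTo-*ˡ k f (suc n) = trans (+-cong (sumTo-*ˡ k f n) refl) (sym (distribˡ k _ _))

  *ₚ-suc : ∀ a b n → (a *ₚ b) (suc n) ≈ a 0 * b (suc n) + ((a ∘ suc) *ₚ b) n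
  *ₚ-suc a b n = sumTo-suc (λ j → a j * b (suc n ∸ j)) n

  *ₚ-cong : ∀ {X X′ Y Y′} → X ≋ X′ → Y ≋ Y′ → X *ₚ Y ≋ X′ *ₚ Y′
  *ₚ-cong X≋X′ Y≋Y′ i = sumTo-cong i (λ j _ → *-cong (X≋X′ j) (Y≋Y′ (i ∸ j)))

  -- A factor of _*ₚ_ is only seen through its coefficients at i ∸ j, so unification cannot
  -- recover it: congruences and algebraic laws take such series explicitly.
  *ₚ-congˡ : ∀ X {Y Y′} → Y ≋ Y′ → X *ₚ Y ≋ X *ₚ Y′
  *ₚ-congˡ X Y≋Y′ = *ₚ-cong {X} {X} (λ _ → refl) Y≋Y′

  *ₚ-congʳ : ∀ Y {X X′} → X ≋ X′ → X *ₚ Y ≋ X′ *ₚ Y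
  *ₚ-congʳ Y X≋X′ = *ₚ-cong {Y = Y} {Y} X≋X′ (λ _ → refl)

  *ₚ-cong-upTo : ∀ {X Y} Z i → (∀ j → j ℕ.≤ i → X j ≈ Y j) → (X *ₚ Z) i ≈ (Y *ₚ Z) i
  *ₚ-cong-upTo Z i X≈Y = sumTo-cong i (λ j j≤i → *-cong (X≈Y j j≤i) refl)

  *ₚ-constantˡ : ∀ a b → (∀ i → a (suc i) ≈ 0#) → ∀ n → (a *ₚ b) n ≈ a 0 * b n
  *ₚ-constantˡ a b a≈0 zero    = refl
  *ₚ-constantˡ a b a≈0 (suc n) = begin
    (a *ₚ b) (suc n)                        ≈⟨ *ₚ-suc a b n ⟩
    a 0 * b (suc n) + ((a ∘ suc) *ₚ b) n    ≈⟨ +-cong refl tail≈0 ⟩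
    a 0 * b (suc n) + 0#                    ≈⟨ +-identityʳ _ ⟩
    a 0 * b (suc n)                         ∎
    where
    tail≈0 : ((a ∘ suc) *ₚ b) n ≈ 0#
    tail≈0 = trans (*ₚ-constantˡ (a ∘ suc) b (a≈0 ∘ suc) n) (trans (*-cong (a≈0 0) refl) (zeroˡ _))

  *ₚ-identityˡ : ∀ b → oneₚ *ₚ b ≋ b
  *ₚ-identityˡ b n = trans (*ₚ-constantˡ oneₚ b (λ _ → refl) n) (*-identityˡ _)

  *ₚ-zeroˡ : ∀ b → zeroₚ *ₚ b ≋ zeroₚ
  *ₚ-zeroˡ b n = trans (*ₚ-constantˡ zeroₚ b (λ _ → refl) n) (zeroˡ _)

  *ₚ-distribʳ : ∀ a a′ b → (a +ₚ a′) *ₚ b ≋ (a *ₚ b) +ₚ (a′ *ₚ b)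
  *ₚ-distribʳ a a′ b n = trans (sumTo-cong n (λ j _ → distribʳ _ _ _)) (sumTo-+ _ _ n)

  ·ₚ-*ₚ : ∀ k a b → (k ·ₚ a) *ₚ b ≋ k ·ₚ (a *ₚ b)
  ·ₚ-*ₚ k a b n = trans (sumTo-cong n (λ j _ → *-assoc _ _ _)) (sumTo-*ˡ k _ n)

  -- Peeling the leading coefficient off a, then off b, reduces index n + 2 to n + 1 and n.
  *ₚ-comm : ∀ a b → a *ₚ b ≋ b *ₚ a
  *ₚ-comm a b zero          = *-comm _ _
  *ₚ-comm a b (suc zero)    = begin
    (a *ₚ b) 1                  ≈⟨ *ₚ-suc a b 0 ⟩
    a 0 * b 1 + a 1 * b 0       ≈⟨ +-comm _ _ ⟩
    a 1 * b 0 + a 0 * b 1       ≈⟨ +-cong (*-comm _ _) (*-comm _ _) ⟩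
    b 0 * a 1 + b 1 * a 0       ≈⟨ *ₚ-suc b a 0 ⟨
    (b *ₚ a) 1                  ∎
  *ₚ-comm a b (suc (suc n)) = begin
    (a *ₚ b) (suc (suc n))
      ≈⟨ *ₚ-suc a b (suc n) ⟩
    a 0 * b (2 ℕ.+ n) + (a′ *ₚ b) (suc n)
      ≈⟨ +-cong refl (trans (*ₚ-comm a′ b (suc n)) (*ₚ-suc b a′ n)) ⟩
    a 0 * b (2 ℕ.+ n) + (b 0 * a (2 ℕ.+ n) + (b′ *ₚ a′) n)
      ≈⟨ +-Properties.x∙yz≈y∙xz _ _ _ ⟩
    b 0 * a (2 ℕ.+ n) + (a 0 * b (2 ℕ.+ n) + (b′ *ₚ a′) n)
      ≈⟨ +-cong refl (+-cong refl (*ₚ-comm b′ a′ n)) ⟩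
    b 0 * a (2 ℕ.+ n) + (a 0 * b (2 ℕ.+ n) + (a′ *ₚ b′) n)
      ≈⟨ +-cong refl (trans (*ₚ-comm b′ a (suc n)) (*ₚ-suc a b′ n)) ⟨
    b 0 * a (2 ℕ.+ n) + (b′ *ₚ a) (suc n)
      ≈⟨ *ₚ-suc b a (suc n) ⟨
    (b *ₚ a) (suc (suc n))
      ∎
    where
    a′ = a ∘ suc
    b′ = b ∘ suc

  *ₚ-assoc : ∀ a b d → (a *ₚ b) *ₚ d ≋ a *ₚ (b *ₚ d)
  *ₚ-assoc a b d zero    = *-assoc _ _ _
  *ₚ-assoc a b d (suc n) = begin
    ((a *ₚ b) *ₚ d) (suc n)
      ≈⟨ *ₚ-suc (a *ₚ b) d n ⟩
    (a 0 * b 0) * d (suc n) + (((a *ₚ b) ∘ suc) *ₚ d) n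
      ≈⟨ +-cong refl (*ₚ-congʳ d (*ₚ-suc a b) n) ⟩
    (a 0 * b 0) * d (suc n) + (((a 0 ·ₚ (b ∘ suc)) +ₚ ((a ∘ suc) *ₚ b)) *ₚ d) n
      ≈⟨ +-cong refl (trans (*ₚ-distribʳ _ _ d n)
                            (+-cong (·ₚ-*ₚ (a 0) (b ∘ suc) d n) (*ₚ-assoc (a ∘ suc) b d n))) ⟩
    (a 0 * b 0) * d (suc n) + (a 0 * ((b ∘ suc) *ₚ d) n + ((a ∘ suc) *ₚ (b *ₚ d)) n)
      ≈⟨ +-assoc _ _ _ ⟨
    ((a 0 * b 0) * d (suc n) + a 0 * ((b ∘ suc) *ₚ d) n) + ((a ∘ suc) *ₚ (b *ₚ d)) n
      ≈⟨ +-cong (trans (+-cong (*-assoc _ _ _) refl) (sym (distribˡ _ _ _))) refl ⟩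
    a 0 * (b 0 * d (suc n) + ((b ∘ suc) *ₚ d) n) + ((a ∘ suc) *ₚ (b *ₚ d)) n
      ≈⟨ +-cong (*-congˡ (*ₚ-suc b d n)) refl ⟨
    a 0 * (b *ₚ d) (suc n) + ((a ∘ suc) *ₚ (b *ₚ d)) n
      ≈⟨ *ₚ-suc a (b *ₚ d) n ⟨
    (a *ₚ (b *ₚ d)) (suc n)
      ∎

  *ₚ-isCommutativeMonoid : IsCommutativeMonoid _≋_ _*ₚ_ oneₚ
  *ₚ-isCommutativeMonoid = isCommutativeMonoidˡ record
    { isSemigroup = record
      { isMagma = record { isEquivalence = Setoid.isEquivalence ≋-setoid ; ∙-cong = *ₚ-cong }
      ; assoc   = *ₚ-assoc
      }
    ; identityˡ   = *ₚ-identityˡ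
    ; comm        = *ₚ-comm
    }

  *ₚ-commutativeMonoid : CommutativeMonoid c ℓ
  *ₚ-commutativeMonoid = record { isCommutativeMonoid = *ₚ-isCommutativeMonoid }

  open CommutativeMonoid *ₚ-commutativeMonoid public using ()
    renaming (identityʳ to *ₚ-identityʳ)
  module *ₚ-Properties =
    CommutativeSemigroupProperties (CommutativeMonoid.commutativeSemigroup *ₚ-commutativeMonoid)

  shift-cong : ∀ K {X Y} → X ≋ Y → shift K X ≋ shift K Y
  shift-cong zero    X≋Y         = X≋Y
  shift-cong (suc K) X≋Y zero    = refl
  shift-cong (suc K) X≋Y (suc i) = shift-cong K X≋Y i

  shift-*ₚ : ∀ K a b → shift K a *ₚ b ≋ shift K (a *ₚ b)
  shift-*ₚ zero    a b         = ≋-refl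
  shift-*ₚ (suc K) a b zero    = zeroˡ _
  shift-*ₚ (suc K) a b (suc n) = begin
    (shift (suc K) a *ₚ b) (suc n)        ≈⟨ *ₚ-suc (shift (suc K) a) b n ⟩
    0# * b (suc n) + (shift K a *ₚ b) n   ≈⟨ +-cong (zeroˡ _) (shift-*ₚ K a b n) ⟩
    0# + shift K (a *ₚ b) n               ≈⟨ +-identityˡ _ ⟩
    shift K (a *ₚ b) n                    ∎

  shift-≥ : ∀ {K i} X → K ℕ.≤ i → shift K X i ≡ X (i ∸ K)
  shift-≥ {zero}          X _         = ≡.refl
  shift-≥ {suc K} {suc i} X (s≤s K≤i) = shift-≥ X K≤i

  shift-< : ∀ {K i} X → i ℕ.< K → shift K X i ≡ 0#
  shift-< {suc K} {zero}  X _         = ≡.refl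
  shift-< {suc K} {suc i} X (s≤s i<K) = shift-< X i<K

  shift-oneₚ-diagonal : ∀ K → shift K oneₚ K ≡ 1#
  shift-oneₚ-diagonal zero    = ≡.refl
  shift-oneₚ-diagonal (suc K) = shift-oneₚ-diagonal K

  shift-oneₚ-> : ∀ {K i} → K ℕ.< i → shift K oneₚ i ≡ 0#
  shift-oneₚ-> {zero}  {suc i} _         = ≡.refl
  shift-oneₚ-> {suc K} {suc i} (s≤s K<i) = shift-oneₚ-> K<i

  linₚ-*ₚ : ∀ a X i → (linₚ a *ₚ X) i ≈ X i + - a * shift 1 X i
  linₚ-*ₚ a X zero    = trans (*-identityˡ _) (sym (trans (+-cong refl (zeroʳ _)) (+-identityʳ _)))
  linₚ-*ₚ a X (suc n) =
    trans (*ₚ-suc (linₚ a) X n) (+-cong (*-identityˡ _) (*ₚ-constantˡ (linₚ a ∘ suc) X (λ _ → refl) n))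

  *ₚ-linₚ : ∀ X a i → (X *ₚ linₚ a) i ≈ X i + - a * shift 1 X i
  *ₚ-linₚ X a i = trans (*ₚ-comm X (linₚ a) i) (linₚ-*ₚ a X i)

  linₚ-inverseʳ : ∀ a → linₚ a *ₚ invLinₚ a ≋ oneₚ
  linₚ-inverseʳ a zero    =
    trans (linₚ-*ₚ a (invLinₚ a) 0) (trans (+-cong refl (zeroʳ _)) (+-identityʳ _))
  linₚ-inverseʳ a (suc n) = trans (linₚ-*ₚ a (invLinₚ a) (suc n))
    (trans (sym (distribʳ _ _ _)) (trans (*-cong (-‿inverseʳ a) refl) (zeroˡ _)))

  linₚ-inverseˡ : ∀ a → invLinₚ a *ₚ linₚ a ≋ oneₚ
  linₚ-inverseˡ a = ≋-trans (*ₚ-comm _ _) (linₚ-inverseʳ a)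

module Laurent {c ℓ} (F : Field c ℓ) where
  open Over F
  open Field F using (setoid; refl; sym)
  open Series F
  open SetoidReasoning setoid

  coeffAtDepth : ℤ → PS → Carrier
  coeffAtDepth (+ k)    X = X k
  coeffAtDepth -[1+ _ ] X = 0#

  coeff≡coeffAtDepth : ∀ L e → coeff L e ≡ coeffAtDepth (top L - e) (co L)
  coeff≡coeffAtDepth L e with top L - e
  ... | + k      = ≡.refl
  ... | -[1+ _ ] = ≡.refl

  coeffAtDepth-cong : ∀ d {X Y} → X ≋ Y → coeffAtDepth d X ≈ coeffAtDepth d Y
  coeffAtDepth-cong (+ k)    X≋Y = X≋Y k
  coeffAtDepth-cong -[1+ _ ] X≋Y = refl

  coeffAtDepth-negative : ∀ {d} X → d ℤ.< + 0 → coeffAtDepth d X ≡ 0#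
  coeffAtDepth-negative { -[1+ _ ] } X _            = ≡.refl
  coeffAtDepth-negative {+ _}       X (ℤ.+<+ ())

  coeff-below-top : ∀ L e {k} → top L - e ≡ + k → coeff L e ≡ co L k
  coeff-below-top L e eq = ≡.trans (coeff≡coeffAtDepth L e) (≡.cong (λ d → coeffAtDepth d (co L)) eq)

  coeff-top : ∀ L → coeff L (top L) ≡ co L 0
  coeff-top L = coeff-below-top L (top L) (ℤ.+-inverseʳ (top L))

  coeff-above-top : ∀ L {e} → top L ℤ.< e → coeff L e ≡ 0#
  coeff-above-top L top<e =
    ≡.trans (coeff≡coeffAtDepth L _) (coeffAtDepth-negative (co L) (m<n⇒m-n<0 top<e))

  co-≋⇒≈ₗ : ∀ L M → top L ≡ top M → co L ≋ co M → L ≈ₗ M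
  co-≋⇒≈ₗ L M top≡ co≋ e = begin
    coeff L e                                 ≡⟨ coeff≡coeffAtDepth L e ⟩
    coeffAtDepth (top L - e) (co L)           ≈⟨ coeffAtDepth-cong (top L - e) co≋ ⟩
    coeffAtDepth (top L - e) (co M)           ≡⟨ ≡.cong (λ t → coeffAtDepth (t - e) (co M)) top≡ ⟩
    coeffAtDepth (top M - e) (co M)           ≡⟨ coeff≡coeffAtDepth M e ⟨
    coeff M e                                 ∎

  ≈ₗ⇒co-≋ : ∀ L M → top L ≡ top M → L ≈ₗ M → co L ≋ co M
  ≈ₗ⇒co-≋ L M top≡ L≈M i = begin
    co L i            ≡⟨ coeff-below-top L e depth ⟨
    coeff L e         ≈⟨ L≈M e ⟩
    coeff M e         ≡⟨ coeff-below-top M e (≡.subst (λ t → t - e ≡ + i) top≡ depth) ⟩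
    co M i            ∎
    where
    e = top L - + i
    depth : top L - e ≡ + i
    depth = m-[m-n]≡n (top L) (+ i)

  top<⇒co₀≈0 : ∀ L M → L ≈ₗ M → top L ℤ.< top M → co M 0 ≈ 0#
  top<⇒co₀≈0 L M L≈M L<M = begin
    co M 0            ≡⟨ coeff-top M ⟨
    coeff M (top M)   ≈⟨ L≈M (top M) ⟨
    coeff L (top M)   ≡⟨ coeff-above-top L L<M ⟩
    0#                ∎

  top-≈ₗ : ∀ L M → L ≈ₗ M → ¬ co L 0 ≈ 0# → ¬ co M 0 ≈ 0# → top L ≡ top M
  top-≈ₗ L M L≈M L₀≉0 M₀≉0 with ℤ.<-cmp (top L) (top M)
  ... | tri< L<M _ _ = ⊥-elim (M₀≉0 (top<⇒co₀≈0 L M L≈M L<M))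
  ... | tri≈ _ L≡M _ = L≡M
  ... | tri> _ _ M<L = ⊥-elim (L₀≉0 (top<⇒co₀≈0 M L (λ e → sym (L≈M e)) M<L))

  co-powₗ : ∀ L n → co (powₗ L n) ≡ powₚ (co L) n
  co-powₗ L zero    = ≡.refl
  co-powₗ L (suc n) = ≡.cong (co L *ₚ_) (co-powₗ L n)

  co-factorₗ : ∀ a m → co (factorₗ a m) ≡ factorₚ a m
  co-factorₗ a (+ n)    = co-powₗ (linₗ a) n
  co-factorₗ a -[1+ n ] = co-powₗ (invLinₗ a) (suc n)

  co-prodₗ : ∀ V → co (prodₗ V) ≡ prodₚ V
  co-prodₗ []            = ≡.refl
  co-prodₗ ((a , m) ∷ V) = ≡.cong₂ _*ₚ_ (co-factorₗ a m) (co-prodₗ V)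

  top-factorₗ : ∀ a m → top (factorₗ a m) ≡ m
  top-factorₗ a (+ zero)       = ≡.refl
  top-factorₗ a (+ suc n)      = ≡.cong (ℤ._+_ (+ 1)) (top-factorₗ a (+ n))
  top-factorₗ a -[1+ zero ]    = ≡.refl
  top-factorₗ a -[1+ suc n ]   = ≡.cong (ℤ._+_ -[1+ 0 ]) (top-factorₗ a -[1+ n ])

  top-prodₗ-uniform : ∀ {A : Set} (g : A → Carrier) m xs →
                      top (prodₗ (map (λ x → (g x , m)) xs)) ≡ + length xs ℤ.* m
  top-prodₗ-uniform g m []       = ≡.refl
  top-prodₗ-uniform g m (x ∷ xs) =
    ≡.trans (≡.cong₂ ℤ._+_ (top-factorₗ (g x) m) (top-prodₗ-uniform g m xs))
            (≡.sym (ℤ.suc-* (+ length xs) m))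

  top-q : ∀ b m → top (q b m) ≡ m
  top-q b (+ n)    = ≡.trans (top-prodₗ-uniform _ (+ 1) (upTo n))
    (≡.trans (≡.cong (λ l → + l ℤ.* + 1) (List.length-upTo n)) (ℤ.*-identityʳ (+ n)))
  top-q b -[1+ n ] = ≡.trans (top-prodₗ-uniform _ -[1+ 0 ] (upTo (suc n)))
    (≡.trans (≡.cong (λ l → + l ℤ.* -[1+ 0 ]) (List.length-upTo (suc n)))
    (≡.trans (≡.sym (ℤ.neg-distribʳ-* (+ suc n) (+ 1))) (≡.cong ℤ.-_ (ℤ.*-identityʳ (+ suc n)))))

module HybridProducts {c ℓ} (F : Field c ℓ) where
  open Over F
  open Field F using (refl; trans; *-cong; *-identityˡ)
  open Series F
  open SetoidReasoning ≋-setoid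
  open *ₚ-Properties using (interchange; x∙yz≈y∙xz; x∙yz≈xz∙y; xy∙z≈xz∙y)

  *ₚ-inverse-unique : ∀ X {Y Z} → X *ₚ Y ≋ oneₚ → X *ₚ Z ≋ oneₚ → Y ≋ Z
  *ₚ-inverse-unique X {Y} {Z} XY≋1 XZ≋1 = begin
    Y                ≈⟨ *ₚ-identityˡ Y ⟨
    oneₚ *ₚ Y        ≈⟨ *ₚ-congʳ Y XZ≋1 ⟨
    (X *ₚ Z) *ₚ Y    ≈⟨ xy∙z≈xz∙y X Z Y ⟩
    (X *ₚ Y) *ₚ Z    ≈⟨ *ₚ-congʳ Z XY≋1 ⟩
    oneₚ *ₚ Z        ≈⟨ *ₚ-identityˡ Z ⟩
    Z                ∎

  powₚ-inverse : ∀ X Y → X *ₚ Y ≋ oneₚ → ∀ n → powₚ X n *ₚ powₚ Y n ≋ oneₚ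
  powₚ-inverse X Y XY≋1 zero    = *ₚ-identityˡ oneₚ
  powₚ-inverse X Y XY≋1 (suc n) = begin
    (X *ₚ powₚ X n) *ₚ (Y *ₚ powₚ Y n)    ≈⟨ interchange X (powₚ X n) Y (powₚ Y n) ⟩
    (X *ₚ Y) *ₚ (powₚ X n *ₚ powₚ Y n)    ≈⟨ *ₚ-cong XY≋1 (powₚ-inverse X Y XY≋1 n) ⟩
    oneₚ *ₚ oneₚ                          ≈⟨ *ₚ-identityˡ oneₚ ⟩
    oneₚ                                  ∎

  factorₚ-inverse : ∀ a m → factorₚ a m *ₚ factorₚ a (ℤ.- m) ≋ oneₚ
  factorₚ-inverse a (+ zero)  = powₚ-inverse (linₚ a) (invLinₚ a) (linₚ-inverseʳ a) 0
  factorₚ-inverse a (+ suc n) = powₚ-inverse (linₚ a) (invLinₚ a) (linₚ-inverseʳ a) (suc n)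
  factorₚ-inverse a -[1+ n ]  = powₚ-inverse (invLinₚ a) (linₚ a) (linₚ-inverseˡ a) (suc n)

  prodₚ-++ : ∀ V W → prodₚ (V ++ W) ≋ prodₚ V *ₚ prodₚ W
  prodₚ-++ []            W = ≋-sym (*ₚ-identityˡ (prodₚ W))
  prodₚ-++ ((a , m) ∷ V) W = begin
    factorₚ a m *ₚ prodₚ (V ++ W)           ≈⟨ *ₚ-congˡ (factorₚ a m) (prodₚ-++ V W) ⟩
    factorₚ a m *ₚ (prodₚ V *ₚ prodₚ W)     ≈⟨ *ₚ-assoc (factorₚ a m) (prodₚ V) (prodₚ W) ⟨
    (factorₚ a m *ₚ prodₚ V) *ₚ prodₚ W     ∎

  prodₚ-negH-inverse : ∀ V → prodₚ V *ₚ prodₚ (negH V) ≋ oneₚ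
  prodₚ-negH-inverse []            = *ₚ-identityˡ oneₚ
  prodₚ-negH-inverse ((a , m) ∷ V) = begin
    (factorₚ a m *ₚ prodₚ V) *ₚ (factorₚ a (ℤ.- m) *ₚ prodₚ (negH V))
      ≈⟨ interchange (factorₚ a m) (prodₚ V) (factorₚ a (ℤ.- m)) (prodₚ (negH V)) ⟩
    (factorₚ a m *ₚ factorₚ a (ℤ.- m)) *ₚ (prodₚ V *ₚ prodₚ (negH V))
      ≈⟨ *ₚ-cong (factorₚ-inverse a m) (prodₚ-negH-inverse V) ⟩
    oneₚ *ₚ oneₚ
      ≈⟨ *ₚ-identityˡ oneₚ ⟩
    oneₚ
      ∎

  prodₚ-cancel : ∀ V W → prodₚ W *ₚ prodₚ (V ++ negH W) ≋ prodₚ V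
  prodₚ-cancel V W = begin
    prodₚ W *ₚ prodₚ (V ++ negH W)
      ≈⟨ *ₚ-congˡ (prodₚ W) (prodₚ-++ V (negH W)) ⟩
    prodₚ W *ₚ (prodₚ V *ₚ prodₚ (negH W))
      ≈⟨ x∙yz≈y∙xz (prodₚ W) (prodₚ V) (prodₚ (negH W)) ⟩
    prodₚ V *ₚ (prodₚ W *ₚ prodₚ (negH W))
      ≈⟨ *ₚ-congˡ (prodₚ V) (prodₚ-negH-inverse W) ⟩
    prodₚ V *ₚ oneₚ
      ≈⟨ *ₚ-identityʳ (prodₚ V) ⟩
    prodₚ V
      ∎

  powₚ-constant : ∀ X n → X 0 ≈ 1# → powₚ X n 0 ≈ 1#
  powₚ-constant X zero    X₀≈1 = refl
  powₚ-constant X (suc n) X₀≈1 = trans (*-cong X₀≈1 (powₚ-constant X n X₀≈1)) (*-identityˡ _)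

  prodₚ-constant : ∀ V → prodₚ V 0 ≈ 1#
  prodₚ-constant []                   = refl
  prodₚ-constant ((a , + n) ∷ V)      =
    trans (*-cong (powₚ-constant (linₚ a) n refl) (prodₚ-constant V)) (*-identityˡ _)
  prodₚ-constant ((a , -[1+ n ]) ∷ V) =
    trans (*-cong (powₚ-constant (invLinₚ a) (suc n) refl) (prodₚ-constant V)) (*-identityˡ _)

  prodₚ-upTo-suc : ∀ (g : ℕ → Carrier) m n →
    prodₚ (map (λ i → (g i , m)) (upTo (suc n)))
      ≋ prodₚ (map (λ i → (g i , m)) (upTo n)) *ₚ factorₚ (g n) m
  prodₚ-upTo-suc g m n = begin
    prodₚ (map h (upTo (suc n)))                  ≡⟨ ≡.cong (prodₚ ∘ map h) (List.upTo-∷ʳ n) ⟨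
    prodₚ (map h (upTo n ++ n ∷ []))              ≡⟨ ≡.cong prodₚ (List.map-++ h (upTo n) (n ∷ [])) ⟩
    prodₚ (map h (upTo n) ++ h n ∷ [])            ≈⟨ prodₚ-++ (map h (upTo n)) (h n ∷ []) ⟩
    prodₚ (map h (upTo n)) *ₚ (factorₚ (g n) m *ₚ oneₚ)
      ≈⟨ *ₚ-congˡ (prodₚ (map h (upTo n))) (*ₚ-identityʳ (factorₚ (g n) m)) ⟩
    prodₚ (map h (upTo n)) *ₚ factorₚ (g n) m     ∎
    where h = λ i → (g i , m)

  module PersistentRoots (b : ℤ → Carrier) where
    qₚ : ℤ → PS
    qₚ m = prodₚ (interval b m)

    q⁻¹ₚ : ℤ → PS
    q⁻¹ₚ m = prodₚ (negH (interval b m))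

    -- The clauses coincide, but -[1+ n ] ℤ.+ + 1 only reduces once n is split.
    qₚ-pred : ∀ n → qₚ -[1+ n ] ≋ qₚ (-[1+ n ] ℤ.+ + 1) *ₚ invLinₚ (b (-[1+ n ] ℤ.+ + 1))
    qₚ-pred zero    = ≋-trans (prodₚ-upTo-suc (b ∘ ℤ.-_ ∘ +_) -[1+ 0 ] 0)
      (*ₚ-congˡ oneₚ (*ₚ-identityʳ (invLinₚ (b (+ 0)))))
    qₚ-pred (suc n) = ≋-trans (prodₚ-upTo-suc (b ∘ ℤ.-_ ∘ +_) -[1+ 0 ] (suc n))
      (*ₚ-congˡ (qₚ -[1+ n ]) (*ₚ-identityʳ (invLinₚ (b -[1+ n ]))))

    qₚ-suc : ∀ m → qₚ (m ℤ.+ + 1) ≋ qₚ m *ₚ linₚ (b (m ℤ.+ + 1))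
    qₚ-suc (+ n) rewrite ℕ.+-comm n 1 = ≋-trans (prodₚ-upTo-suc (b ∘ +_ ∘ suc) (+ 1) n)
      (*ₚ-congˡ (qₚ (+ n)) (*ₚ-identityʳ (linₚ (b (+ suc n)))))
    qₚ-suc m@(-[1+ n ]) = begin
      Q                                ≈⟨ *ₚ-identityʳ Q ⟨
      Q *ₚ oneₚ                        ≈⟨ *ₚ-congˡ Q (linₚ-inverseˡ a) ⟨
      Q *ₚ (invLinₚ a *ₚ linₚ a)       ≈⟨ *ₚ-assoc Q (invLinₚ a) (linₚ a) ⟨
      (Q *ₚ invLinₚ a) *ₚ linₚ a       ≈⟨ *ₚ-congʳ (linₚ a) (qₚ-pred n) ⟨
      qₚ m *ₚ linₚ a                   ∎
      where
      a = b (m ℤ.+ + 1)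
      Q = qₚ (m ℤ.+ + 1)

    qₚ-linₚ-inverse : ∀ m → (qₚ m *ₚ linₚ (b (m ℤ.+ + 1))) *ₚ q⁻¹ₚ (m ℤ.+ + 1) ≋ oneₚ
    qₚ-linₚ-inverse m = ≋-trans (*ₚ-congʳ (q⁻¹ₚ (m ℤ.+ + 1)) (≋-sym (qₚ-suc m)))
                                (prodₚ-negH-inverse (interval b (m ℤ.+ + 1)))

    q⁻¹ₚ-suc : ∀ m → q⁻¹ₚ m ≋ q⁻¹ₚ (m ℤ.+ + 1) *ₚ linₚ (b (m ℤ.+ + 1))
    q⁻¹ₚ-suc m = *ₚ-inverse-unique (qₚ m) (prodₚ-negH-inverse (interval b m))
      (≋-trans (x∙yz≈xz∙y (qₚ m) (q⁻¹ₚ (m ℤ.+ + 1)) (linₚ (b (m ℤ.+ + 1))))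
               (qₚ-linₚ-inverse m))

module ExpansionLemma {c ℓ} (F : Field c ℓ) where
  open Over F
  open Field F using (setoid; refl; sym; trans; reflexive; +-cong; *-congˡ; +-identityˡ;
    +-identityʳ; *-identityʳ; zeroʳ; +-commutativeSemigroup)
  open Series F
  open SetoidReasoning setoid
  open CommutativeSemigroupProperties +-commutativeSemigroup using (xy∙z≈xz∙y)

  -- q k, ι k and a k play the roles of Q_{n-k}, 1 / Q_{n-k+1} and b_{n-k+1}.
  module Expansion (G : PS) (q ι : ℕ → PS) (a : ℕ → Carrier)
                   (inverse : ∀ k → (q k *ₚ linₚ (a k)) *ₚ ι k ≋ oneₚ)
                   (ι-suc : ∀ k → ι (suc k) ≋ ι k *ₚ linₚ (a k)) where

    coefficient : ℕ → Carrier
    coefficient k = (G *ₚ ι k) k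

    partialSum : ℕ → PS
    partialSum zero    = zeroₚ
    partialSum (suc K) = partialSum K +ₚ (coefficient K ·ₚ shift K (q K))

    partialQuotient : ℕ → PS
    partialQuotient K = partialSum K *ₚ ι K

    multiply-back : ∀ K X → X ≋ (X *ₚ ι K) *ₚ (q K *ₚ linₚ (a K))
    multiply-back K X = ≋-trans (≋-sym (*ₚ-identityʳ X))
      (≋-trans (*ₚ-congˡ X (≋-sym (inverse K)))
               (*ₚ-Properties.x∙yz≈xz∙y X (q K *ₚ linₚ (a K)) (ι K)))

    partialQuotient-suc : ∀ K →
      partialQuotient (suc K) ≋ (partialQuotient K *ₚ linₚ (a K)) +ₚ (coefficient K ·ₚ shift K oneₚ)
    partialQuotient-suc K i = begin
      (partialSum (suc K) *ₚ ι (suc K)) i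
        ≈⟨ *ₚ-congˡ (partialSum (suc K)) (ι-suc K) i ⟩
      ((partialSum K +ₚ (coefficient K ·ₚ tᴷq)) *ₚ (ι K *ₚ l)) i
        ≈⟨ *ₚ-distribʳ (partialSum K) (coefficient K ·ₚ tᴷq) (ι K *ₚ l) i ⟩
      (partialSum K *ₚ (ι K *ₚ l)) i + ((coefficient K ·ₚ tᴷq) *ₚ (ι K *ₚ l)) i
        ≈⟨ +-cong (sym (*ₚ-assoc (partialSum K) (ι K) l i)) (·ₚ-*ₚ (coefficient K) tᴷq (ι K *ₚ l) i) ⟩
      (partialQuotient K *ₚ l) i + coefficient K * (tᴷq *ₚ (ι K *ₚ l)) i
        ≈⟨ +-cong refl (*-congˡ (trans (shift-*ₚ K (q K) (ι K *ₚ l) i) (shift-cong K q-ι-l≋1 i))) ⟩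
      (partialQuotient K *ₚ l) i + coefficient K * shift K oneₚ i
        ∎
      where
      l = linₚ (a K)
      tᴷq = shift K (q K)
      q-ι-l≋1 : q K *ₚ (ι K *ₚ l) ≋ oneₚ
      q-ι-l≋1 = ≋-trans (*ₚ-Properties.x∙yz≈xz∙y (q K) (ι K) l) (inverse K)

    partialQuotient-vanishes : ∀ {K i} → K ℕ.≤ i → partialQuotient K i ≈ 0#
    partialQuotient-vanishes {zero}  {i}     _         = *ₚ-zeroˡ (ι 0) i
    partialQuotient-vanishes {suc K} {suc i} (s≤s K≤i) = begin
      partialQuotient (suc K) (suc i)
        ≈⟨ partialQuotient-suc K (suc i) ⟩
      (W *ₚ linₚ (a K)) (suc i) + coefficient K * shift K oneₚ (suc i)
        ≈⟨ +-cong (*ₚ-linₚ W (a K) (suc i)) refl ⟩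
      (W (suc i) + - a K * W i) + coefficient K * shift K oneₚ (suc i)
        ≈⟨ +-cong (+-cong (partialQuotient-vanishes (ℕ.m≤n⇒m≤1+n K≤i))
                          (*-congˡ (partialQuotient-vanishes K≤i)))
                  (*-congˡ (reflexive (shift-oneₚ-> (s≤s K≤i)))) ⟩
      (0# + - a K * 0#) + coefficient K * 0#
        ≈⟨ +-cong (trans (+-identityˡ _) (zeroʳ _)) (zeroʳ _) ⟩
      0# + 0#
        ≈⟨ +-identityʳ 0# ⟩
      0#
        ∎
      where W = partialQuotient K

    Gι≈partialQuotient-below : ∀ {K i} → i ℕ.< K → (G *ₚ ι K) i ≈ partialQuotient K i
    Gι≈partialQuotient-below {suc K} {i} (s≤s i≤K) = begin
      (G *ₚ ι (suc K)) i
        ≈⟨ *ₚ-congˡ G (ι-suc K) i ⟩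
      (G *ₚ (ι K *ₚ l)) i
        ≈⟨ *ₚ-assoc G (ι K) l i ⟨
      ((G *ₚ ι K) *ₚ l) i
        ≈⟨ *ₚ-linₚ (G *ₚ ι K) (a K) i ⟩
      (G *ₚ ι K) i + - a K * shift 1 (G *ₚ ι K) i
        ≈⟨ +-cong Gι≈W+cₖtᴷ (*-congˡ (shifted i i≤K)) ⟩
      (W i + coefficient K * shift K oneₚ i) + - a K * shift 1 W i
        ≈⟨ xy∙z≈xz∙y (W i) _ _ ⟩
      (W i + - a K * shift 1 W i) + coefficient K * shift K oneₚ i
        ≈⟨ +-cong (*ₚ-linₚ W (a K) i) refl ⟨
      (W *ₚ l) i + coefficient K * shift K oneₚ i
        ≈⟨ partialQuotient-suc K i ⟨
      partialQuotient (suc K) i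
        ∎
      where
      W = partialQuotient K
      l = linₚ (a K)
      cₖ = coefficient K

      shifted : ∀ j → j ℕ.≤ K → shift 1 (G *ₚ ι K) j ≈ shift 1 W j
      shifted zero    _   = refl
      shifted (suc j) j<K = Gι≈partialQuotient-below j<K

      Gι≈W+cₖtᴷ : (G *ₚ ι K) i ≈ W i + coefficient K * shift K oneₚ i
      Gι≈W+cₖtᴷ with ℕ.m≤n⇒m<n∨m≡n i≤K
      ... | inj₁ i<K    = begin
        (G *ₚ ι K) i                 ≈⟨ Gι≈partialQuotient-below i<K ⟩
        W i                          ≈⟨ +-identityʳ (W i) ⟨
        W i + 0#                     ≈⟨ +-cong refl (zeroʳ cₖ) ⟨
        W i + cₖ * 0#                ≡⟨ ≡.cong (λ x → W i + cₖ * x) (shift-< oneₚ i<K) ⟨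
        W i + cₖ * shift K oneₚ i    ∎
      ... | inj₂ ≡.refl = begin
        cₖ                           ≈⟨ *-identityʳ cₖ ⟨
        cₖ * 1#                      ≈⟨ +-identityˡ (cₖ * 1#) ⟨
        0# + cₖ * 1#                 ≈⟨ +-cong (partialQuotient-vanishes {K} ℕ.≤-refl) refl ⟨
        W K + cₖ * 1#                ≡⟨ ≡.cong (λ x → W K + cₖ * x) (shift-oneₚ-diagonal K) ⟨
        W K + cₖ * shift K oneₚ K    ∎

    G≈partialSum-below : ∀ {K i} → i ℕ.< K → G i ≈ partialSum K i
    G≈partialSum-below {K} {i} i<K = begin
      G i                                           ≈⟨ multiply-back K G i ⟩
      ((G *ₚ ι K) *ₚ P) i                           ≈⟨ *ₚ-cong-upTo P i Gι≈W-upTo-i ⟩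
      (partialQuotient K *ₚ P) i                    ≈⟨ multiply-back K (partialSum K) i ⟨
      partialSum K i                                ∎
      where
      P = q K *ₚ linₚ (a K)
      Gι≈W-upTo-i : ∀ j → j ℕ.≤ i → (G *ₚ ι K) j ≈ partialQuotient K j
      Gι≈W-upTo-i j j≤i = Gι≈partialQuotient-below (ℕ.≤-<-trans j≤i i<K)

    partialSum-suc : ∀ K i → partialSum (suc K) i ≈ sumTo (λ k → coefficient k * shift k (q k) i) K
    partialSum-suc zero    i = +-identityˡ _
    partialSum-suc (suc K) i = +-cong (partialSum-suc K i) refl

    expansion : ∀ i → G i ≈ sumTo (λ k → coefficient k * q k (i ∸ k)) i
    expansion i = begin
      G i                                               ≈⟨ G≈partialSum-below ℕ.≤-refl ⟩
      partialSum (suc i) i                              ≈⟨ partialSum-suc i i ⟩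
      sumTo (λ k → coefficient k * shift k (q k) i) i   ≈⟨ sumTo-cong i shift-≤ ⟩
      sumTo (λ k → coefficient k * q k (i ∸ k)) i       ∎
      where
      shift-≤ : ∀ k → k ℕ.≤ i → coefficient k * shift k (q k) i ≈ coefficient k * q k (i ∸ k)
      shift-≤ k k≤i = *-congˡ (reflexive (shift-≥ (q k) k≤i))

module CoefficientSeries {c ℓ} (F : Field c ℓ) where
  open Over F
  open Field F using (setoid; reflexive; *-cong; *-congˡ; *-identityʳ)
  open Series F
  open Laurent F
  open HybridProducts F
  open ExpansionLemma F
  open SetoidReasoning setoid

  co-polyₗ : ∀ p V → polyₗ p ≈ₗ scaleₗ (lc p) (prodₗ V) → co (polyₗ p) ≋ lc p ·ₚ prodₚ V
  co-polyₗ p V p≈ i = begin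
    co (polyₗ p) i          ≈⟨ ≈ₗ⇒co-≋ (polyₗ p) L top≡ p≈ i ⟩
    lc p * co (prodₗ V) i   ≡⟨ ≡.cong (λ X → lc p * X i) (co-prodₗ V) ⟩
    lc p * prodₚ V i        ∎
    where
    L = scaleₗ (lc p) (prodₗ V)
    leading≉0 : ¬ lc p * co (prodₗ V) 0 ≈ 0#
    leading≉0 leading≈0 = lc≉0 p (begin
      lc p                    ≈⟨ *-identityʳ (lc p) ⟨
      lc p * 1#               ≈⟨ *-congˡ (prodₚ-constant V) ⟨
      lc p * prodₚ V 0        ≡⟨ ≡.cong (λ X → lc p * X 0) (co-prodₗ V) ⟨
      lc p * co (prodₗ V) 0   ≈⟨ leading≈0 ⟩
      0#                      ∎)
    top≡ : top (polyₗ p) ≡ top L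
    top≡ = top-≈ₗ (polyₗ p) L p≈ (lc≉0 p) leading≉0

  module _ (b : ℤ → Carrier) (n : ℤ) (R : Hybrid) where
    open PersistentRoots b

    coeff-q : ∀ {k i} → k ℕ.≤ i → coeff (q b (n - + k)) (n - + i) ≡ qₚ (n - + k) (i ∸ k)
    coeff-q {k} {i} k≤i = ≡.trans (coeff-below-top (q b (n - + k)) (n - + i) depth)
                                  (≡.cong (λ X → X (i ∸ k)) (co-prodₗ (interval b (n - + k))))
      where
      depth : top (q b (n - + k)) - (n - + i) ≡ + (i ∸ k)
      depth = ≡.trans (≡.cong (_- (n - + i)) (top-q b (n - + k)))
                      (≡.trans ([m-n]-[m-o]≡o-n n (+ k) (+ i)) (+m-+n≡+[m∸n] k≤i))

    open Expansion (prodₚ R) (λ k → qₚ (n - + k)) (λ k → q⁻¹ₚ (n - + k ℤ.+ + 1))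
      (λ k → b (n - + k ℤ.+ + 1)) (λ k → qₚ-linₚ-inverse (n - + k))
      (λ k → ≋-trans (≋-reflexive (≡.cong q⁻¹ₚ (m-[1+n]+1≡m-n n (+ k)))) (q⁻¹ₚ-suc (n - + k)))

    co-expansionSum : co (expansionSum b n R) ≋ prodₚ R
    co-expansionSum i = begin
      co (expansionSum b n R) i
        ≈⟨ sumTo-cong i (λ k k≤i → *-cong (prodₚ-++ R _ k) (reflexive (coeff-q k≤i))) ⟩
      sumTo (λ k → coefficient k * qₚ (n - + k) (i ∸ k)) i
        ≈⟨ expansion i ⟨
      prodₚ R i
        ∎

mainTheorem5 : ∀ {c ℓ} (F : Field c ℓ) → let open Over F in
    CharZero → AlgClosed →
    (p r : Poly) (n : ℤ) (b : ℤ → Carrier) (αs βs : List Carrier) →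
    -- f = p / r is monic of degree n
    lc p ≈ lc r → (+ deg p) - (+ deg r) ≡ n →
    -- complete factorisations of p and r, so Roots(f) = αs - βs
    polyₗ p ≈ₗ scaleₗ (lc p) (prodₗ (ofList αs)) →
    polyₗ r ≈ₗ scaleₗ (lc r) (prodₗ (ofList βs)) →
    -- f = Σ_k comp_k(Roots(f) - {b_1..b_{n-k+1}}) q_{n-k}, i.e. r · (Σ …) = p in Laurent series
    (polyₗ r *ₗ expansionSum b n (rootsFrac αs βs)) ≈ₗ polyₗ p
mainTheorem5 F _ _ p r n b αs βs lc-p≈lc-r degree p-factors r-factors =
  co-≋⇒≈ₗ (polyₗ r *ₗ expansionSum b n R) (polyₗ p) top-≡ λ i → begin
    (co (polyₗ r) *ₚ co (expansionSum b n R)) i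
      ≈⟨ *ₚ-cong (co-polyₗ r (ofList βs) r-factors) (co-expansionSum b n R) i ⟩
    ((lc r ·ₚ β) *ₚ prodₚ R) i
      ≈⟨ ·ₚ-*ₚ (lc r) β (prodₚ R) i ⟩
    lc r * (β *ₚ prodₚ R) i
      ≈⟨ *-cong (sym lc-p≈lc-r) (prodₚ-cancel (ofList αs) (ofList βs) i) ⟩
    lc p * prodₚ (ofList αs) i
      ≈⟨ co-polyₗ p (ofList αs) p-factors i ⟨
    co (polyₗ p) i
      ∎
  where
  open Over F
  open Field F using (setoid; sym; *-cong)
  open Series F
  open Laurent F
  open HybridProducts F
  open CoefficientSeries F
  open SetoidReasoning setoid
  R = rootsFrac αs βs
  β = prodₚ (ofList βs)
  top-≡ : + deg r ℤ.+ n ≡ + deg p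
  top-≡ = ≡.trans (≡.cong (ℤ._+_ (+ deg r)) (≡.sym degree)) (n+[m-n]≡m (+ deg p) (+ deg r))
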